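{- Let $n\ge2$, $k\in\{1,\dots,n-1\}$, and let $b=(B_{ij},L)\in B^k$ be a $k$-rectangle. Let $T$, $U$, $V$ be the semistandard tableaux corresponding to $b$, $\widetilde{\mathrm{rot}}(b)$ and $\widetilde{\mathrm{refl}}(b)$ respectively. Then (1) $U$ is obtained by rotating $T$ by 180 degrees and replacing each entry $i$ with $n-i+1$; (2) $V$ is obtained by replacing each column of $T$ with the complement in $[n]$ of the entries of that column (arranged in increasing order), and then reversing the order of the columns.
   Context: Notation: $[n]=\{1,\dots,n\}$. For $m\in[n-1]$ let $R_m=\{(i,j):1\le i\le m,\ i\le j\le i+n-m-1\}$. A point $b=(B_{ij},L)\in\mathbb Z^{R_m}\times\mathbb Z$ is an $m$-rectangle if the triangular array $(A_{ij})_{1\le i\le j\le n}$ with $A_{ij}=B_{ij}$ for $(i,j)\in R_m$ and $A_{ij}=L$ for $j>i+n-m-1$ has all entries $\ge0$ and satisfies $A_{i,j+1}\ge A_{ij}\ge A_{i+1,j+1}$ for $1\le i\le j\le n-1$; $B^m$ denotes the set of $m$-rectangles. $m$-rectangles with parameter $L$ correspond bijectively to semistandard Young tableaux (rows weakly increasing, columns strictly increasing) of rectangular shape with $m$ rows and $L$ columns and entries in $[n]$, via $B_{ij}=$ the number of entries $\le j$ in row $i$. Rotation $\widetilde{\mathrm{rot}}:B^k\to B^k$: $\widetilde{\mathrm{rot}}(B_{ij},L)=(B'_{ij},L)$ with $B'_{ij}=L-B_{k-i+1,n-j}$. Reflection $\widetilde{\mathrm{refl}}:B^k\to B^{n-k}$: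 $\widetilde{\mathrm{refl}}(B_{ij},L)=(B''_{ij},L)$ with $B''_{ij}=L-B_{j-i+1,j}$ for $(i,j)\in R_{n-k}$. -}

module Defs where

open import Data.Nat using (ℕ; zero; suc; _+_; _∸_; _≤_; _<_; _≤?_; _<?_; _≟_)
open import Data.Integer using (ℤ; +_) renaming (_≤_ to _≤ℤ_; _-_ to _-ℤ_)
open import Data.List using (List; map; upTo; filter; length)
open import Data.List.Membership.DecPropositional _≟_ using (_∈?_)
open import Data.Product using (_×_)
open import Relation.Nullary using (¬?; yes; no)
open import Relation.Binary.PropositionalEquality using (_≡_)

range1 : ℕ → List ℕ
range1 n = map suc (upTo n)

rowEnd : ℕ → ℕ → ℕ → ℕ
rowEnd n m i = i + (n ∸ m) ∸ 1

InR : ℕ → ℕ → ℕ → ℕ → Set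
InR n m i j = (1 ≤ i) × (i ≤ m) × (i ≤ j) × (j ≤ rowEnd n m i)

-- The triangular array A attached to (B , L) (data B only used on R_m).
arr : ℕ → ℕ → (ℕ → ℕ → ℤ) → ℤ → ℕ → ℕ → ℤ
arr n m B L i j with m <? i | j ≤? rowEnd n m i
... | yes _ | _     = + 0
... | no _  | yes _ = B i j
... | no _  | no _  = L

IsRect : ℕ → ℕ → (ℕ → ℕ → ℤ) → ℤ → Set
IsRect n m B L =
  (∀ i j → 1 ≤ i → i ≤ j → j ≤ n → + 0 ≤ℤ A i j) ×
  (∀ i j → 1 ≤ i → i ≤ j → j ≤ n ∸ 1 →
     (A i j ≤ℤ A i (suc j)) × (A (suc i) (suc j) ≤ℤ A i j))
  where
  A = arr n m B L

rotB : ℕ → ℕ → (ℕ → ℕ → ℤ) → ℤ → ℕ → ℕ → ℤ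
rotB n k B L i j = L -ℤ B (k + 1 ∸ i) (n ∸ j)

reflB : ℕ → ℕ → (ℕ → ℕ → ℤ) → ℤ → ℕ → ℕ → ℤ
reflB n k B L i j = L -ℤ B (j + 1 ∸ i) j

-- T r c = entry in row r, column c (1-indexed); shape m rows × L columns
IsSSYT : ℕ → ℕ → ℕ → (ℕ → ℕ → ℕ) → Set
IsSSYT n m L T =
  (∀ r c → 1 ≤ r → r ≤ m → 1 ≤ c → c ≤ L → (1 ≤ T r c) × (T r c ≤ n)) ×
  (∀ r c → 1 ≤ r → r ≤ m → 1 ≤ c → suc c ≤ L → T r c ≤ T r (suc c)) ×
  (∀ r c → 1 ≤ r → suc r ≤ m → 1 ≤ c → c ≤ L → T r c < T (suc r) c)

countLe : ℕ → (ℕ → ℕ → ℕ) → ℕ → ℕ → ℕ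
countLe L T i j = length (filter (λ c → T i c ≤? j) (range1 L))

Corresponds : ℕ → ℕ → (ℕ → ℕ → ℤ) → ℕ → (ℕ → ℕ → ℕ) → Set
Corresponds n m B L T =
  IsSSYT n m L T × (∀ i j → InR n m i j → B i j ≡ + countLe L T i j)

column : ℕ → (ℕ → ℕ → ℕ) → ℕ → List ℕ
column m T c = map (λ r → T r c) (range1 m)

complement : ℕ → List ℕ → List ℕ
complement n xs = filter (λ x → ¬? (x ∈? xs)) (range1 n)

-- A weakly increasing row f of length L is recovered from its counting function
-- j ↦ #{d | f d ≤ j}: the c-th entry is ≤ j exactly when c ≤ #{d | f d ≤ j}.  Rotation
-- and reflection both replace a value B by L − B, so they pair two rows whose counting
-- functions sum to L, and for such rows the c-th entry of one is ≤ j exactly when the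
-- (L + 1 − c)-th entry of the other is > j′.
-- For the rotation (row r of U against row k + 1 − r of T, at j′ = n − j) this says that
-- U r c and n + 1 − T (k + 1 − r) (L + 1 − c) are ≤ the same j throughout the window
-- r ≤ j < r + n − k, which contains both of them, so they are equal.
-- For the reflection (row i of V against row p of T, at j = j′ = i + p − 1) it says that
-- the i-th entry of column c of V and the p-th entry of column L + 1 − c of T lie on
-- opposite sides of i + p − 1; two strictly increasing sequences of lengths n − k and k
-- that interleave in this way partition [n].
module Submission where

open import Defs
open import Data.Nat
  using (ℕ; zero; suc; _+_; _∸_; _≤_; _≰_; _<_; _≤?_; _<?_; _≟_; z≤n; s≤s; s≤s⁻¹)
open import Data.Nat.Properties
open import Data.List using (List; []; _∷_; _∷ʳ_; _++_; map; filter; length; applyUpTo)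
open import Data.List.Properties
  using (map-upTo; applyUpTo-∷ʳ; length-applyUpTo; length-++; length-filter;
         filter-++; filter-all; filter-accept; filter-reject)
open import Data.List.Membership.Propositional using (_∈_; _∉_)
open import Data.List.Membership.DecPropositional _≟_ using (_∈?_)
open import Data.List.Membership.Propositional.Properties
  using (∈-applyUpTo⁺; ∈-applyUpTo⁻; ∈-map⁺; ∈-map⁻; ∈-filter⁺; ∈-filter⁻)
open import Data.List.Relation.Unary.AllPairs using (AllPairs; []; _∷_)
import Data.List.Relation.Unary.AllPairs.Properties as AllPairs
open import Data.Product using (_×_; _,_; proj₁; proj₂; uncurry; ∃-syntax)
open import Data.List.Relation.Unary.All using (All)
import Data.List.Relation.Unary.All as All
open import Data.List.Relation.Unary.Any using (here; there)
open import Data.Integer using (ℤ; +_; _-_)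
import Data.Integer.Properties as ℤ
open import Data.Empty using (⊥-elim)
open import Data.Sum using (inj₁; inj₂)
open import Function using (_⇔_; mk⇔; Equivalence)
open import Relation.Nullary using (yes; no; ¬?)
open import Relation.Binary.PropositionalEquality

open Equivalence using (to; from)
open import Function.Properties.Equivalence using () renaming (trans to ⇔-trans; sym to ⇔-sym)

range1≡applyUpTo : ∀ n → range1 n ≡ applyUpTo suc n
range1≡applyUpTo = map-upTo suc

∈-range1⁺ : ∀ {x} n → 1 ≤ x → x ≤ n → x ∈ range1 n
∈-range1⁺ n (s≤s z≤n) x≤n =
  subst (_ ∈_) (sym (range1≡applyUpTo n)) (∈-applyUpTo⁺ suc x≤n)

∈-range1⁻ : ∀ {x} n → x ∈ range1 n → 1 ≤ x × x ≤ n
∈-range1⁻ n x∈ with ∈-applyUpTo⁻ suc (subst (_ ∈_) (range1≡applyUpTo n) x∈)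
... | _ , i<n , refl = s≤s z≤n , i<n

range1-∷ʳ : ∀ n → range1 (suc n) ≡ range1 n ∷ʳ suc n
range1-∷ʳ n = begin
  range1 (suc n)           ≡⟨ range1≡applyUpTo (suc n) ⟩
  applyUpTo suc (suc n)    ≡⟨ applyUpTo-∷ʳ suc n ⟨
  applyUpTo suc n ∷ʳ suc n ≡⟨ cong (_∷ʳ suc n) (range1≡applyUpTo n) ⟨
  range1 n ∷ʳ suc n        ∎
  where open ≡-Reasoning

length-range1 : ∀ n → length (range1 n) ≡ n
length-range1 n = trans (cong length (range1≡applyUpTo n)) (length-applyUpTo suc n)

-- Increasing sequences and strictly sorted lists

Monotone : ℕ → (ℕ → ℕ) → Set
Monotone L f = ∀ c → 1 ≤ c → suc c ≤ L → f c ≤ f (suc c)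

StrictlyIncreasing : ℕ → (ℕ → ℕ) → Set
StrictlyIncreasing L f = ∀ c → 1 ≤ c → suc c ≤ L → f c < f (suc c)

Monotone⇒≤ : ∀ {L f c d} → Monotone L f → 1 ≤ c → c ≤ d → d ≤ L → f c ≤ f d
Monotone⇒≤ {d = zero} mono (s≤s z≤n) ()
Monotone⇒≤ {d = suc d} mono 1≤c c≤1+d 1+d≤L with m≤n⇒m<n∨m≡n c≤1+d
... | inj₂ refl       = ≤-refl
... | inj₁ (s≤s c≤d) =
  ≤-trans (Monotone⇒≤ mono 1≤c c≤d (<⇒≤ 1+d≤L)) (mono d (≤-trans 1≤c c≤d) 1+d≤L)

StrictlyIncreasing⇒Monotone : ∀ {L f} → StrictlyIncreasing L f → Monotone L f
StrictlyIncreasing⇒Monotone incr c 1≤c 1+c≤L = <⇒≤ (incr c 1≤c 1+c≤L)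

StrictlyIncreasing⇒+≤ : ∀ {L f c} d → StrictlyIncreasing L f → 1 ≤ c → c + d ≤ L →
                        f c + d ≤ f (c + d)
StrictlyIncreasing⇒+≤ {f = f} {c} zero incr 1≤c c≤L
  rewrite +-identityʳ (f c) | +-identityʳ c = ≤-refl
StrictlyIncreasing⇒+≤ {f = f} {c} (suc d) incr 1≤c c+1+d≤L
  rewrite +-suc (f c) d | +-suc c d =
  ≤-trans (s≤s (StrictlyIncreasing⇒+≤ d incr 1≤c (<⇒≤ c+1+d≤L)))
          (incr (c + d) (≤-trans 1≤c (m≤m+n c d)) c+1+d≤L)

StrictlyIncreasing⇒< : ∀ {L f c d} → StrictlyIncreasing L f →
                       1 ≤ c → c < d → d ≤ L → f c < f d
StrictlyIncreasing⇒< {f = f} {c} {d} incr 1≤c c<d d≤L = begin-strict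
  f c               <⟨ m<m+n (f c) (m<n⇒0<n∸m c<d) ⟩
  f c + (d ∸ c)     ≤⟨ StrictlyIncreasing⇒+≤ (d ∸ c) incr 1≤c c+[d∸c]≤L ⟩
  f (c + (d ∸ c))   ≡⟨ cong f (m+[n∸m]≡n (<⇒≤ c<d)) ⟩
  f d               ∎
  where
  open ≤-Reasoning
  c+[d∸c]≤L = ≤-trans (≤-reflexive (m+[n∸m]≡n (<⇒≤ c<d))) d≤L

AllPairs-<-≡ : ∀ {xs ys : List ℕ} → AllPairs _<_ xs → AllPairs _<_ ys →
               (∀ {x} → x ∈ xs → x ∈ ys) → (∀ {x} → x ∈ ys → x ∈ xs) → xs ≡ ys
AllPairs-<-≡ {[]}     {[]}     _ _ _ _ = refl
AllPairs-<-≡ {[]}     {y ∷ ys} _ _ _ ys⊆xs with () ← ys⊆xs (here refl)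
AllPairs-<-≡ {x ∷ xs} {[]}     _ _ xs⊆ys _ with () ← xs⊆ys (here refl)
AllPairs-<-≡ {x ∷ xs} {y ∷ ys} (x< ∷ xs<) (y< ∷ ys<) xs⊆ys ys⊆xs =
  cong₂ _∷_ x≡y
    (AllPairs-<-≡ xs< ys< (tail x≡y x< y< xs⊆ys) (tail (sym x≡y) y< x< ys⊆xs))
  where
  x≡y : x ≡ y
  x≡y with xs⊆ys (here refl) | ys⊆xs (here refl)
  ... | here x≡y | _          = x≡y
  ... | there _  | here y≡x   = sym y≡x
  ... | there x∈ys | there y∈xs = ⊥-elim (<-asym (All.lookup y< x∈ys) (All.lookup x< y∈xs))
  tail : ∀ {a b as bs} → a ≡ b → All (a <_) as → All (b <_) bs →
         (∀ {z} → z ∈ a ∷ as → z ∈ b ∷ bs) → ∀ {z} → z ∈ as → z ∈ bs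
  tail a≡b a< b< as⊆ z∈as with as⊆ (there z∈as)
  ... | here refl = ⊥-elim (<-irrefl a≡b (All.lookup a< z∈as))
  ... | there z∈bs = z∈bs

AllPairs-<-map-range1 : ∀ {n f} → StrictlyIncreasing n f → AllPairs _<_ (map f (range1 n))
AllPairs-<-map-range1 {n} {f} incr =
  subst (λ xs → AllPairs _<_ (map f xs)) (sym (range1≡applyUpTo n))
    (AllPairs.map⁺ (AllPairs.applyUpTo⁺₁ suc n λ i<j j<n →
      StrictlyIncreasing⇒< incr (s≤s z≤n) (s≤s i<j) j<n))

AllPairs-<-complement : ∀ n xs → AllPairs _<_ (complement n xs)
AllPairs-<-complement n _ = AllPairs.filter⁺ _ (subst (AllPairs _<_) (sym (range1≡applyUpTo n))
  (AllPairs.applyUpTo⁺₁ suc n λ i<j _ → s≤s i<j))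

∈-map-range1⁺ : ∀ {i} (f : ℕ → ℕ) n → 1 ≤ i → i ≤ n → f i ∈ map f (range1 n)
∈-map-range1⁺ f n 1≤i i≤n = ∈-map⁺ f (∈-range1⁺ n 1≤i i≤n)

∈-map-range1⁻ : ∀ {x} (f : ℕ → ℕ) n → x ∈ map f (range1 n) →
                ∃[ i ] 1 ≤ i × i ≤ n × x ≡ f i
∈-map-range1⁻ f n x∈ with i , i∈ , refl ← ∈-map⁻ f x∈
                     with 1≤i , i≤n ← ∈-range1⁻ n i∈ = i , 1≤i , i≤n , refl

∈-complement⁺ : ∀ {x} n xs → 1 ≤ x → x ≤ n → x ∉ xs → x ∈ complement n xs
∈-complement⁺ n xs 1≤x x≤n x∉xs =
  ∈-filter⁺ (λ y → ¬? (y ∈? xs)) (∈-range1⁺ n 1≤x x≤n) x∉xs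

∈-complement⁻ : ∀ {x} n xs → x ∈ complement n xs → 1 ≤ x × x ≤ n × x ∉ xs
∈-complement⁻ n xs x∈ with x∈range , x∉xs ← ∈-filter⁻ (λ y → ¬? (y ∈? xs)) x∈
                      with 1≤x , x≤n ← ∈-range1⁻ n x∈range = 1≤x , x≤n , x∉xs

-- Counting entries below a threshold

-- countLe L T i j unfolds to count≤ (T i) L j.
count≤ : (ℕ → ℕ) → ℕ → ℕ → ℕ
count≤ f L j = length (filter (λ c → f c ≤? j) (range1 L))

count≤-≤ : ∀ f L j → count≤ f L j ≤ L
count≤-≤ f L j =
  ≤-trans (length-filter (λ c → f c ≤? j) (range1 L)) (≤-reflexive (length-range1 L))

count≤-suc : ∀ f L j →
             count≤ f (suc L) j ≡ count≤ f L j + length (filter (λ c → f c ≤? j) (suc L ∷ []))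
count≤-suc f L j = begin
  count≤ f (suc L) j
    ≡⟨ cong (λ xs → length (filter P? xs)) (range1-∷ʳ L) ⟩
  length (filter P? (range1 L ∷ʳ suc L))
    ≡⟨ cong length (filter-++ P? (range1 L) (suc L ∷ [])) ⟩
  length (filter P? (range1 L) ++ filter P? (suc L ∷ []))
    ≡⟨ length-++ (filter P? (range1 L)) ⟩
  count≤ f L j + length (filter P? (suc L ∷ [])) ∎
  where
  open ≡-Reasoning
  P? = λ c → f c ≤? j

count≤-accept : ∀ f L j → f (suc L) ≤ j → count≤ f (suc L) j ≡ count≤ f L j + 1
count≤-accept f L j f[1+L]≤j =
  trans (count≤-suc f L j)
        (cong (λ xs → count≤ f L j + length xs) (filter-accept (λ c → f c ≤? j) f[1+L]≤j))

count≤-reject : ∀ f L j → f (suc L) ≰ j → count≤ f (suc L) j ≡ count≤ f L j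
count≤-reject f L j f[1+L]≰j =
  trans (count≤-suc f L j)
        (trans (cong (λ xs → count≤ f L j + length xs) (filter-reject (λ c → f c ≤? j) f[1+L]≰j))
               (+-identityʳ _))

count≤-all : ∀ f L j → (∀ c → 1 ≤ c → c ≤ L → f c ≤ j) → count≤ f L j ≡ L
count≤-all f L j all≤j = trans
  (cong length (filter-all (λ c → f c ≤? j)
                 (All.tabulate λ c∈ → uncurry (all≤j _) (∈-range1⁻ L c∈))))
  (length-range1 L)

≤count≤⇔ : ∀ {f L c} j → Monotone L f → 1 ≤ c → c ≤ L → (c ≤ count≤ f L j ⇔ f c ≤ j)
≤count≤⇔ {L = zero} j mono (s≤s z≤n) ()
≤count≤⇔ {f} {suc L} {c} j mono 1≤c c≤1+L with f (suc L) ≤? j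
... | yes f[1+L]≤j = mk⇔ (λ _ → fc≤j) (λ _ → subst (c ≤_) (sym count≡′) c≤1+L)
  where
  fc≤j = ≤-trans (Monotone⇒≤ mono 1≤c c≤1+L ≤-refl) f[1+L]≤j
  count≡′ : count≤ f (suc L) j ≡ suc L
  count≡′ = trans (count≤-accept f L j f[1+L]≤j)
    (trans (cong (_+ 1) (count≤-all f L j λ d 1≤d d≤L →
              ≤-trans (Monotone⇒≤ mono 1≤d (m≤n⇒m≤1+n d≤L) ≤-refl) f[1+L]≤j))
           (+-comm L 1))
... | no  f[1+L]≰j rewrite count≤-reject f L j f[1+L]≰j
  with m≤n⇒m<n∨m≡n c≤1+L
...   | inj₁ (s≤s c≤L) = ≤count≤⇔ j (λ d 1≤d 1+d≤L → mono d 1≤d (m≤n⇒m≤1+n 1+d≤L)) 1≤c c≤L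
...   | inj₂ refl      = mk⇔ (λ c≤count → ⊥-elim (<⇒≱ (s≤s (count≤-≤ f L j)) c≤count))
                             (λ f[1+L]≤j → ⊥-elim (f[1+L]≰j f[1+L]≤j))

≤⇔≤⇒<⇔< : ∀ {a b c d} → (a ≤ b ⇔ c ≤ d) → (b < a ⇔ d < c)
≤⇔≤⇒<⇔< a≤b⇔c≤d = mk⇔
  (λ b<a → ≰⇒> λ c≤d → <⇒≱ b<a (from a≤b⇔c≤d c≤d))
  (λ d<c → ≰⇒> λ a≤b → <⇒≱ d<c (to a≤b⇔c≤d a≤b))

≤⇔<-complementary : ∀ {L a b c c′} → a + b ≡ L → c + c′ ≡ suc L → (c ≤ a ⇔ b < c′)
≤⇔<-complementary {L} {a} {b} {c} {c′} a+b≡L c+c′≡1+L = mk⇔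
  (λ c≤a → +-cancelˡ-≤ c (suc b) c′ (begin
    c + suc b   ≡⟨ +-suc c b ⟩
    suc (c + b) ≤⟨ s≤s (+-monoˡ-≤ b c≤a) ⟩
    suc (a + b) ≡⟨ cong suc a+b≡L ⟩
    suc L       ≡⟨ c+c′≡1+L ⟨
    c + c′      ∎))
  (λ b<c′ → +-cancelʳ-≤ (suc b) c a (begin
    c + suc b   ≤⟨ +-monoʳ-≤ c b<c′ ⟩
    c + c′      ≡⟨ c+c′≡1+L ⟩
    suc L       ≡⟨ cong suc a+b≡L ⟨
    suc (a + b) ≡⟨ +-suc a b ⟨
    a + suc b   ∎))
  where open ≤-Reasoning

≤⇔<-counts : ∀ {f g L j j′ c c′} → Monotone L f → Monotone L g →
             count≤ f L j + count≤ g L j′ ≡ L → c + c′ ≡ suc L →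
             1 ≤ c → c ≤ L → 1 ≤ c′ → c′ ≤ L → (f c ≤ j ⇔ j′ < g c′)
≤⇔<-counts {j = j} {j′} monoF monoG counts c+c′ 1≤c c≤L 1≤c′ c′≤L =
  ⇔-trans (⇔-sym (≤count≤⇔ j monoF 1≤c c≤L))
  (⇔-trans (≤⇔<-complementary counts c+c′)
           (≤⇔≤⇒<⇔< (≤count≤⇔ j′ monoG 1≤c′ c′≤L)))

+1∸-mirror : ∀ {N x} → 1 ≤ x → x ≤ N →
             1 ≤ N + 1 ∸ x × N + 1 ∸ x ≤ N × x + (N + 1 ∸ x) ≡ suc N
+1∸-mirror {N} {x} 1≤x x≤N =
    m<n⇒0<n∸m x<N+1
  , ≤-trans (∸-monoʳ-≤ (N + 1) 1≤x) (≤-reflexive (m+n∸n≡m N 1))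
  , trans (m+[n∸m]≡n (<⇒≤ x<N+1)) (+-comm N 1)
  where
  x<N+1 : x < N + 1
  x<N+1 = ≤-trans (s≤s x≤N) (≤-reflexive (+-comm 1 N))

∸<⇔+1∸≤ : ∀ {n j t} → j ≤ n → (n ∸ j < t ⇔ n + 1 ∸ t ≤ j)
∸<⇔+1∸≤ {n} {j} {t} j≤n = mk⇔
  (λ n∸j<t → m≤n+o⇒m∸n≤o (n + 1) t (begin
    n + 1           ≡⟨ n+1≡ ⟩
    suc (n ∸ j) + j ≤⟨ +-monoˡ-≤ j n∸j<t ⟩
    t + j           ∎))
  (λ n+1∸t≤j → +-cancelʳ-≤ j (suc (n ∸ j)) t (begin
    suc (n ∸ j) + j ≡⟨ n+1≡ ⟨
    n + 1           ≤⟨ m≤n+m∸n (n + 1) t ⟩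
    t + (n + 1 ∸ t) ≤⟨ +-monoʳ-≤ t n+1∸t≤j ⟩
    t + j           ∎))
  where
  open ≤-Reasoning
  n+1≡ : n + 1 ≡ suc (n ∸ j) + j
  n+1≡ = trans (+-comm n 1) (cong suc (sym (m∸n+n≡m j≤n)))

m-n≡o⇒o+n≡m : ∀ {m n o} → + m - + n ≡ + o → n ≤ m → o + n ≡ m
m-n≡o⇒o+n≡m {m} {n} {o} m-n≡o n≤m = begin
  o + n       ≡⟨ cong (_+ n) (ℤ.+-injective +o≡+[m∸n]) ⟩
  m ∸ n + n   ≡⟨ m∸n+n≡m n≤m ⟩
  m           ∎
  where
  open ≡-Reasoning
  +o≡+[m∸n] : + o ≡ + (m ∸ n)
  +o≡+[m∸n] = trans (sym m-n≡o) (trans (ℤ.m-n≡m⊖n m n) (ℤ.⊖-≥ n≤m))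

≤-by-thresholds : ∀ {lo hi u w} → lo ≤ w → u ≤ hi →
                  (∀ j → lo ≤ j → j < hi → w ≤ j → u ≤ j) → u ≤ w
≤-by-thresholds {hi = hi} {w = w} lo≤w u≤hi below with w <? hi
... | yes w<hi = below w lo≤w w<hi ≤-refl
... | no  w≮hi = ≤-trans u≤hi (≮⇒≥ w≮hi)

≡-by-thresholds : ∀ {lo hi u w} → lo ≤ u → u ≤ hi → lo ≤ w → w ≤ hi →
                  (∀ j → lo ≤ j → j < hi → (u ≤ j ⇔ w ≤ j)) → u ≡ w
≡-by-thresholds lo≤u u≤hi lo≤w w≤hi same = ≤-antisym
  (≤-by-thresholds lo≤w u≤hi λ j lo≤j j<hi → from (same j lo≤j j<hi))
  (≤-by-thresholds lo≤u w≤hi λ j lo≤j j<hi → to (same j lo≤j j<hi))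

-- Interleaved sequences

Interleaved : ℕ → ℕ → (ℕ → ℕ) → (ℕ → ℕ) → Set
Interleaved M k v t = ∀ i p → 1 ≤ i → i ≤ M → p < k → (v i ≤ i + p ⇔ i + p < t (suc p))

module _ {n M k : ℕ} {v t : ℕ → ℕ} (k+M≡n : k + M ≡ n)
         (v-bounds : ∀ {i} → 1 ≤ i → i ≤ M → i ≤ v i × v i ≤ i + k)
         (t-bounds : ∀ {p} → 1 ≤ p → p ≤ k → p ≤ t p × t p ≤ p + M)
         (interleave : Interleaved M k v t) where

  interleaved-disjoint : ∀ {i q} → 1 ≤ i → i ≤ M → 1 ≤ q → q ≤ k → v i ≢ t q
  interleaved-disjoint {i} {suc p} 1≤i i≤M _ 1+p≤k vi≡tq with v i ≤? i + p
  ... | yes vi≤i+p =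
    <⇒≱ (to (interleave i p 1≤i i≤M 1+p≤k) vi≤i+p) (subst (_≤ i + p) vi≡tq vi≤i+p)
  ... | no  vi≰i+p =
    vi≰i+p (from (interleave i p 1≤i i≤M 1+p≤k) (subst (i + p <_) vi≡tq (≰⇒> vi≰i+p)))

  private
    Rank : ℕ → ℕ → Set
    Rank a x = ∀ {q} → 1 ≤ q → q ≤ k → (q ≤ a ⇔ t q < x)

    Rank⇒< : ∀ {x} a → 1 ≤ x → a ≤ k → Rank a x → a < x
    Rank⇒< zero    1≤x _   _     = 1≤x
    Rank⇒< (suc b) _   a≤k rank =
      ≤-<-trans (proj₁ (t-bounds (s≤s z≤n) a≤k)) (to (rank (s≤s z≤n) a≤k) ≤-refl)

    Rank⇒≤v : ∀ {x i} a → i + a ≡ x → 1 ≤ i → i ≤ M → a ≤ k → Rank a x → x ≤ v i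
    Rank⇒≤v {i = i} zero i+0≡x 1≤i i≤M _ _ =
      subst (_≤ v i) (trans (sym (+-identityʳ i)) i+0≡x) (proj₁ (v-bounds 1≤i i≤M))
    Rank⇒≤v {i = i} (suc b) i+1+b≡x 1≤i i≤M a≤k rank =
      subst (_≤ v i) (trans (sym (+-suc i b)) i+1+b≡x) (≰⇒> vi≰i+b)
      where
      t≤i+b : t (suc b) ≤ i + b
      t≤i+b = s≤s⁻¹ (subst (t (suc b) <_) (trans (sym i+1+b≡x) (+-suc i b))
                           (to (rank (s≤s z≤n) a≤k) ≤-refl))
      vi≰i+b : v i ≰ i + b
      vi≰i+b vi≤i+b = <⇒≱ (to (interleave i b 1≤i i≤M a≤k) vi≤i+b) t≤i+b

    Rank⇒≤M×v≤ : ∀ {x i a} → x ≤ n → (∀ {q} → 1 ≤ q → q ≤ k → t q ≢ x) →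
                  i + a ≡ x → 1 ≤ i → a ≤ k → Rank a x → i ≤ M × v i ≤ x
    Rank⇒≤M×v≤ {x} {i} {a} x≤n x∉t i+a≡x 1≤i a≤k rank with m≤n⇒m<n∨m≡n a≤k
    ... | inj₂ refl = i≤M , subst (v i ≤_) i+a≡x (proj₂ (v-bounds 1≤i i≤M))
      where
      i≤M : i ≤ M
      i≤M = +-cancelʳ-≤ k i M (begin
        i + k ≡⟨ i+a≡x ⟩
        x     ≤⟨ x≤n ⟩
        n     ≡⟨ k+M≡n ⟨
        k + M ≡⟨ +-comm k M ⟩
        M + k ∎)
        where open ≤-Reasoning
    ... | inj₁ a<k = i≤M , vi≤x
      where
      x<t : x < t (suc a)
      x<t = ≤∧≢⇒< (≮⇒≥ λ t<x → <-irrefl refl (from (rank (s≤s z≤n) a<k) t<x))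
                  (λ x≡t → x∉t (s≤s z≤n) a<k (sym x≡t))
      i≤M : i ≤ M
      i≤M = +-cancelʳ-≤ a i M (s≤s⁻¹ (begin-strict
        i + a       ≡⟨ i+a≡x ⟩
        x           <⟨ x<t ⟩
        t (suc a)   ≤⟨ proj₂ (t-bounds (s≤s z≤n) a<k) ⟩
        suc a + M   ≡⟨ cong suc (+-comm a M) ⟩
        suc (M + a) ∎))
        where open ≤-Reasoning
      vi≤x : v i ≤ x
      vi≤x = subst (v i ≤_) i+a≡x
               (from (interleave i a 1≤i i≤M a<k) (subst (_< t (suc a)) (sym i+a≡x) x<t))

    -- If exactly a entries of t lie below x and x is not one of them, x is the (x − a)-th entry of v.
    interleaved-covers : ∀ {x a} → 1 ≤ x → x ≤ n → (∀ {q} → 1 ≤ q → q ≤ k → t q ≢ x) →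
                         a ≤ k → Rank a x → ∃[ i ] 1 ≤ i × i ≤ M × v i ≡ x
    interleaved-covers {x} {a} 1≤x x≤n x∉t a≤k rank =
      i , 1≤i , i≤M , ≤-antisym vi≤x (Rank⇒≤v a i+a≡x 1≤i i≤M a≤k rank)
      where
      a<x = Rank⇒< a 1≤x a≤k rank
      i = x ∸ a
      1≤i : 1 ≤ i
      1≤i = m<n⇒0<n∸m a<x
      i+a≡x : i + a ≡ x
      i+a≡x = m∸n+n≡m (<⇒≤ a<x)
      bounds = Rank⇒≤M×v≤ x≤n x∉t i+a≡x 1≤i a≤k rank
      i≤M = proj₁ bounds
      vi≤x = proj₂ bounds

  interleaved⇒complement : StrictlyIncreasing M v → StrictlyIncreasing k t →
                           map v (range1 M) ≡ complement n (map t (range1 k))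
  interleaved⇒complement v-incr t-incr =
    AllPairs-<-≡ (AllPairs-<-map-range1 v-incr) (AllPairs-<-complement n _) v⊆ ⊆v
    where
    v⊆ : ∀ {x} → x ∈ map v (range1 M) → x ∈ complement n (map t (range1 k))
    v⊆ x∈ with i , 1≤i , i≤M , refl ← ∈-map-range1⁻ v M x∈ =
      ∈-complement⁺ n _ (≤-trans 1≤i (proj₁ (v-bounds 1≤i i≤M))) vi≤n vi∉t
      where
      vi≤n : v i ≤ n
      vi≤n = begin
        v i   ≤⟨ proj₂ (v-bounds 1≤i i≤M) ⟩
        i + k ≤⟨ +-monoˡ-≤ k i≤M ⟩
        M + k ≡⟨ +-comm M k ⟩
        k + M ≡⟨ k+M≡n ⟩
        n     ∎
        where open ≤-Reasoning
      vi∉t : v i ∉ map t (range1 k)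
      vi∉t vi∈t with q , 1≤q , q≤k , vi≡tq ← ∈-map-range1⁻ t k vi∈t =
        interleaved-disjoint 1≤i i≤M 1≤q q≤k vi≡tq
    ∉t⇒≢ : ∀ {x} → x ∉ map t (range1 k) → ∀ {q} → 1 ≤ q → q ≤ k → t q ≢ x
    ∉t⇒≢ x∉t 1≤q q≤k tq≡x =
      x∉t (subst (_∈ map t (range1 k)) tq≡x (∈-map-range1⁺ t k 1≤q q≤k))
    count≤-rank : ∀ x {q} → 1 ≤ q → q ≤ k → (q ≤ count≤ t k x ⇔ t q < suc x)
    count≤-rank x 1≤q q≤k =
      ⇔-trans (≤count≤⇔ x (StrictlyIncreasing⇒Monotone t-incr) 1≤q q≤k) (mk⇔ s≤s s≤s⁻¹)
    ⊆v : ∀ {x} → x ∈ complement n (map t (range1 k)) → x ∈ map v (range1 M)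
    ⊆v {zero}  x∈ with () ← proj₁ (∈-complement⁻ n _ x∈)
    ⊆v {suc x} x∈ with 1≤x , x≤n , x∉t ← ∈-complement⁻ n _ x∈
      with i , 1≤i , i≤M , vi≡x ←
             interleaved-covers 1≤x x≤n (∉t⇒≢ x∉t) (count≤-≤ t k x) (count≤-rank x) =
      subst (_∈ map v (range1 M)) vi≡x (∈-map-range1⁺ v M 1≤i i≤M)

-- Tableaux and rectangles

module _ {n m L : ℕ} {T : ℕ → ℕ → ℕ} (ssyt : IsSSYT n m L T) where

  row-monotone : ∀ {r} → 1 ≤ r → r ≤ m → Monotone L (T r)
  row-monotone 1≤r r≤m c 1≤c 1+c≤L = proj₁ (proj₂ ssyt) _ c 1≤r r≤m 1≤c 1+c≤L

  column-increasing : ∀ {c} → 1 ≤ c → c ≤ L → StrictlyIncreasing m (λ r → T r c)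
  column-increasing 1≤c c≤L r 1≤r 1+r≤m = proj₂ (proj₂ ssyt) r _ 1≤r 1+r≤m 1≤c c≤L

  entry-bounds : ∀ {r c} → m ≤ n → 1 ≤ r → r ≤ m → 1 ≤ c → c ≤ L →
                 r ≤ T r c × T r c ≤ r + (n ∸ m)
  entry-bounds {r} {c} m≤n 1≤r r≤m 1≤c c≤L = lower , upper
    where
    incr : StrictlyIncreasing m (λ s → T s c)
    incr = column-increasing 1≤c c≤L
    in-range : ∀ {s} → 1 ≤ s → s ≤ m → 1 ≤ T s c × T s c ≤ n
    in-range 1≤s s≤m = proj₁ ssyt _ c 1≤s s≤m 1≤c c≤L
    1≤m = ≤-trans 1≤r r≤m
    lower : r ≤ T r c
    lower = begin
      r                      ≡⟨ 1+[r∸1]≡r ⟨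
      1 + (r ∸ 1)            ≤⟨ +-monoˡ-≤ (r ∸ 1) (proj₁ (in-range ≤-refl 1≤m)) ⟩
      T 1 c + (r ∸ 1)        ≤⟨ StrictlyIncreasing⇒+≤ (r ∸ 1) incr ≤-refl (≤-trans (≤-reflexive 1+[r∸1]≡r) r≤m) ⟩
      T (1 + (r ∸ 1)) c      ≡⟨ cong (λ s → T s c) 1+[r∸1]≡r ⟩
      T r c                  ∎
      where
      open ≤-Reasoning
      1+[r∸1]≡r = m+[n∸m]≡n 1≤r
    upper : T r c ≤ r + (n ∸ m)
    upper = +-cancelʳ-≤ (m ∸ r) (T r c) (r + (n ∸ m)) (begin
      T r c + (m ∸ r)        ≤⟨ StrictlyIncreasing⇒+≤ (m ∸ r) incr 1≤r (≤-reflexive (m+[n∸m]≡n r≤m)) ⟩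
      T (r + (m ∸ r)) c      ≡⟨ cong (λ s → T s c) (m+[n∸m]≡n r≤m) ⟩
      T m c                  ≤⟨ proj₂ (in-range 1≤m ≤-refl) ⟩
      n                      ≡⟨ m+[n∸m]≡n m≤n ⟨
      m + (n ∸ m)            ≡⟨ cong (_+ (n ∸ m)) (m+[n∸m]≡n r≤m) ⟨
      r + (m ∸ r) + (n ∸ m)  ≡⟨ +-assoc r (m ∸ r) (n ∸ m) ⟩
      r + ((m ∸ r) + (n ∸ m)) ≡⟨ cong (λ x → r + x) (+-comm (m ∸ r) (n ∸ m)) ⟩
      r + ((n ∸ m) + (m ∸ r)) ≡⟨ +-assoc r (n ∸ m) (m ∸ r) ⟨
      r + (n ∸ m) + (m ∸ r)  ∎)
      where open ≤-Reasoning

InR-intro : ∀ {n m i j} → 1 ≤ i → i ≤ m → i ≤ j → j < i + (n ∸ m) → InR n m i j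
InR-intro {n} {m} {i} {j} 1≤i i≤m i≤j j<end =
  1≤i , i≤m , i≤j , subst (j ≤_) (pred[m∸n]≡m∸[1+n] (i + (n ∸ m)) 0) (<⇒≤pred j<end)

entry≤⇔mirrored-entry> :
  ∀ {n m m′ L T T′ r r′ j j′ c} {β : ℤ} → IsSSYT n m L T → IsSSYT n m′ L T′ →
  1 ≤ r → r ≤ m → 1 ≤ r′ → r′ ≤ m′ →
  + L - β ≡ + countLe L T r j → β ≡ + countLe L T′ r′ j′ → 1 ≤ c → c ≤ L →
  (T r c ≤ j ⇔ j′ < T′ r′ (L + 1 ∸ c))
entry≤⇔mirrored-entry> {L = L} {T′ = T′} {r′ = r′} {j′ = j′}
                       ssyt ssyt′ 1≤r r≤m 1≤r′ r′≤m′ L-β≡ β≡ 1≤c c≤L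
  with 1≤c′ , c′≤L , c+c′≡1+L ← +1∸-mirror 1≤c c≤L =
  ≤⇔<-counts (row-monotone ssyt 1≤r r≤m) (row-monotone ssyt′ 1≤r′ r′≤m′)
    (m-n≡o⇒o+n≡m (subst (λ β → + L - β ≡ _) β≡ L-β≡) (count≤-≤ (T′ r′) L j′))
    c+c′≡1+L 1≤c c≤L 1≤c′ c′≤L

rotation-entry : ∀ {n k B L T U} → k ≤ n →
  Corresponds n k B L T → Corresponds n k (rotB n k B (+ L)) L U →
  ∀ r c → 1 ≤ r → r ≤ k → 1 ≤ c → c ≤ L → U r c ≡ n + 1 ∸ T (k + 1 ∸ r) (L + 1 ∸ c)
rotation-entry {n} {k} {L = L} {T} {U} k≤n (ssytT , countT) (ssytU , countU) r c 1≤r r≤k 1≤c c≤L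
  with 1≤i , i≤k , r+i≡1+k ← +1∸-mirror 1≤r r≤k
     | 1≤c′ , c′≤L , _ ← +1∸-mirror 1≤c c≤L =
  ≡-by-thresholds (proj₁ U-bounds) (proj₂ U-bounds) r≤n+1∸t n+1∸t≤r+M same-thresholds
  where
  M = n ∸ k
  i = k + 1 ∸ r
  t = T i (L + 1 ∸ c)
  U-bounds = entry-bounds ssytU k≤n 1≤r r≤k 1≤c c≤L
  t-bounds = entry-bounds ssytT k≤n 1≤i i≤k 1≤c′ c′≤L
  n+1≡i+[r+M] : n + 1 ≡ i + (r + M)
  n+1≡i+[r+M] = begin
    n + 1         ≡⟨ +-comm n 1 ⟩
    suc n         ≡⟨ cong suc (m+[n∸m]≡n k≤n) ⟨
    suc k + M     ≡⟨ cong (_+ M) r+i≡1+k ⟨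
    (r + i) + M   ≡⟨ cong (_+ M) (+-comm r i) ⟩
    (i + r) + M   ≡⟨ +-assoc i r M ⟩
    i + (r + M)   ∎
    where open ≡-Reasoning
  n+1≡[i+M]+r : n + 1 ≡ (i + M) + r
  n+1≡[i+M]+r = trans n+1≡i+[r+M] (trans (cong (λ x → i + x) (+-comm r M)) (sym (+-assoc i M r)))
  r≤n+1∸t : r ≤ n + 1 ∸ t
  r≤n+1∸t = begin
    r                   ≡⟨ m+n∸m≡n (i + M) r ⟨
    (i + M) + r ∸ (i + M) ≡⟨ cong (_∸ (i + M)) n+1≡[i+M]+r ⟨
    n + 1 ∸ (i + M)     ≤⟨ ∸-monoʳ-≤ (n + 1) (proj₂ t-bounds) ⟩
    n + 1 ∸ t           ∎
    where open ≤-Reasoning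
  n+1∸t≤r+M : n + 1 ∸ t ≤ r + M
  n+1∸t≤r+M = begin
    n + 1 ∸ t           ≤⟨ ∸-monoʳ-≤ (n + 1) (proj₁ t-bounds) ⟩
    n + 1 ∸ i           ≡⟨ cong (_∸ i) n+1≡i+[r+M] ⟩
    i + (r + M) ∸ i     ≡⟨ m+n∸m≡n i (r + M) ⟩
    r + M               ∎
    where open ≤-Reasoning
  same-thresholds : ∀ j → r ≤ j → j < r + M → (U r c ≤ j ⇔ n + 1 ∸ t ≤ j)
  same-thresholds j r≤j j<r+M = ⇔-trans
    (entry≤⇔mirrored-entry> ssytU ssytT 1≤r r≤k 1≤i i≤k
       (countU r j (InR-intro 1≤r r≤k r≤j j<r+M))
       (countT i (n ∸ j) (InR-intro 1≤i i≤k i≤n∸j n∸j<i+M)) 1≤c c≤L)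
    (∸<⇔+1∸≤ j≤n)
    where
    i+j≤n : i + j ≤ n
    i+j≤n = s≤s⁻¹ (begin
      suc (i + j)       ≡⟨ +-suc i j ⟨
      i + suc j         ≤⟨ +-monoʳ-≤ i j<r+M ⟩
      i + (r + M)       ≡⟨ n+1≡i+[r+M] ⟨
      n + 1             ≡⟨ +-comm n 1 ⟩
      suc n             ∎)
      where open ≤-Reasoning
    i≤n∸j = m+n≤o⇒m≤o∸n i i+j≤n
    j≤n = m+n≤o⇒n≤o i i+j≤n
    n∸j<i+M : n ∸ j < i + M
    n∸j<i+M = +-cancelʳ-≤ j (suc (n ∸ j)) (i + M) (begin
      suc (n ∸ j) + j   ≡⟨ cong suc (m∸n+n≡m j≤n) ⟩
      suc n             ≡⟨ +-comm 1 n ⟩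
      n + 1             ≡⟨ n+1≡[i+M]+r ⟩
      (i + M) + r       ≤⟨ +-monoʳ-≤ (i + M) r≤j ⟩
      (i + M) + j       ∎)
      where open ≤-Reasoning

reflection-column : ∀ {n k B L T V} → k ≤ n →
  Corresponds n k B L T → Corresponds n (n ∸ k) (reflB n k B (+ L)) L V →
  ∀ c → 1 ≤ c → c ≤ L → column (n ∸ k) V c ≡ complement n (column k T (L + 1 ∸ c))
reflection-column {n} {k} {B} {L} {T} {V} k≤n (ssytT , countT) (ssytV , countV) c 1≤c c≤L
  with 1≤c′ , c′≤L , _ ← +1∸-mirror 1≤c c≤L =
  interleaved⇒complement (m+[n∸m]≡n k≤n) v-bounds t-bounds interleave
    (column-increasing ssytV 1≤c c≤L) (column-increasing ssytT 1≤c′ c′≤L)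
  where
  M = n ∸ k
  c′ = L + 1 ∸ c
  n∸M≡k : n ∸ M ≡ k
  n∸M≡k = m∸[m∸n]≡n k≤n
  v-bounds : ∀ {i} → 1 ≤ i → i ≤ M → i ≤ V i c × V i c ≤ i + k
  v-bounds {i} 1≤i i≤M with i≤v , v≤ ← entry-bounds ssytV (m∸n≤m n k) 1≤i i≤M 1≤c c≤L =
    i≤v , subst (λ x → V i c ≤ i + x) n∸M≡k v≤
  t-bounds : ∀ {p} → 1 ≤ p → p ≤ k → p ≤ T p c′ × T p c′ ≤ p + M
  t-bounds 1≤p p≤k = entry-bounds ssytT k≤n 1≤p p≤k 1≤c′ c′≤L
  interleave : Interleaved M k (λ i → V i c) (λ p → T p c′)
  interleave i p 1≤i i≤M p<k =
    entry≤⇔mirrored-entry> ssytV ssytT 1≤i i≤M (s≤s z≤n) p<k L-β≡ β≡ 1≤c c≤L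
    where
    i+p+1∸i≡1+p : i + p + 1 ∸ i ≡ suc p
    i+p+1∸i≡1+p = trans (cong (_∸ i) (+-assoc i p 1)) (trans (m+n∸m≡n i (p + 1)) (+-comm p 1))
    i+p<i+[n∸M] : i + p < i + (n ∸ M)
    i+p<i+[n∸M] = subst (λ x → i + p < i + x) (sym n∸M≡k) (+-monoʳ-< i p<k)
    i+p<1+p+M : i + p < suc p + M
    i+p<1+p+M = s≤s (≤-trans (+-monoˡ-≤ p i≤M) (≤-reflexive (+-comm M p)))
    L-β≡ : + L - B (suc p) (i + p) ≡ + countLe L V i (i + p)
    L-β≡ = subst (λ q → + L - B q (i + p) ≡ + countLe L V i (i + p)) i+p+1∸i≡1+p
             (countV i (i + p) (InR-intro 1≤i i≤M (m≤m+n i p) i+p<i+[n∸M]))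
    β≡ : B (suc p) (i + p) ≡ + countLe L T (suc p) (i + p)
    β≡ = countT (suc p) (i + p) (InR-intro (s≤s z≤n) p<k (+-monoˡ-≤ p 1≤i) i+p<1+p+M)

lemma2p12 : (n k : ℕ) → 2 ≤ n → 1 ≤ k → k ≤ n ∸ 1 →
    (B : ℕ → ℕ → ℤ) (L : ℕ) → IsRect n k B (+ L) →
    (T U V : ℕ → ℕ → ℕ) →
    Corresponds n k B L T →
    Corresponds n k (rotB n k B (+ L)) L U →
    Corresponds n (n ∸ k) (reflB n k B (+ L)) L V →
    (∀ r c → 1 ≤ r → r ≤ k → 1 ≤ c → c ≤ L →
       U r c ≡ n + 1 ∸ T (k + 1 ∸ r) (L + 1 ∸ c)) ×
    (∀ c → 1 ≤ c → c ≤ L →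
       column (n ∸ k) V c ≡ complement n (column k T (L + 1 ∸ c)))
lemma2p12 n k _ _ k≤n∸1 B L _ T U V corrT corrU corrV =
  rotation-entry k≤n corrT corrU , reflection-column k≤n corrT corrV
  where
  k≤n : k ≤ n
  k≤n = ≤-trans k≤n∸1 (m∸n≤m n 1)
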